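{- For every positive integer $h$ there exists $N$ such that the following holds. If $G$ is a graph with $|V(G)|\ge N$ such that neither $G$ nor $\bar{G}$ is edgeless or a star, then $G$ contains an induced subgraph $J$ with $|V(J)|=h$ such that $J$ or $\bar{J}$ either has exactly one edge, or is obtained from a star by deleting one edge, or is the join of a graph on two vertices and an independent set.
   Context: Graphs are finite and simple; $\bar G$ denotes the complement of $G$. A star is a graph $K_{1,m}$. The join of two vertex-disjoint graphs is obtained from their disjoint union by adding all edges between them. -}

module Defs where

open import Data.Nat using (ℕ)
open import Data.Bool using (Bool; true; false; not; T; if_then_else_)
open import Data.Fin using (Fin; _≟_)
open import Data.Product using (Σ; ∃; ∃-syntax; _×_; _,_)
open import Data.Sum using (_⊎_)
open import Function.Bundles using (_⇔_)
open import Function.Definitions using (Injective)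
open import Relation.Nullary using (¬_; yes; no)
open import Relation.Binary.PropositionalEquality using (_≡_; _≢_; refl; sym)

record Graph (n : ℕ) : Set where
  field
    adj     : Fin n → Fin n → Bool
    adj-sym : ∀ u v → adj u v ≡ adj v u
    adj-irr : ∀ u → adj u u ≡ false
open Graph public

Adj : ∀ {n} → Graph n → Fin n → Fin n → Set
Adj G u v = T (adj G u v)

compl-adj : ∀ {n} → Graph n → Fin n → Fin n → Bool
compl-adj G u v with u ≟ v
... | yes _ = false
... | no  _ = not (adj G u v)

compl-sym : ∀ {n} (G : Graph n) u v → compl-adj G u v ≡ compl-adj G v u
compl-sym G u v with u ≟ v | v ≟ u
... | yes _ | yes _ = refl
... | yes p | no ¬q = Data.Empty.⊥-elim (¬q (sym p)) where import Data.Empty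
... | no ¬p | yes q = Data.Empty.⊥-elim (¬p (sym q)) where import Data.Empty
... | no _  | no _ rewrite adj-sym G u v = refl

compl-irr : ∀ {n} (G : Graph n) u → compl-adj G u u ≡ false
compl-irr G u with u ≟ u
... | yes _ = refl
... | no ¬p = Data.Empty.⊥-elim (¬p refl) where import Data.Empty

complement : ∀ {n} → Graph n → Graph n
complement G = record { adj = compl-adj G ; adj-sym = compl-sym G ; adj-irr = compl-irr G }

-- Induced subgraph on the image of an injective map f : Fin h → Fin n
-- (the vertex i of the induced graph is the vertex f i of G).
induced : ∀ {n h} → Graph n → (f : Fin h → Fin n) → Graph h
induced G f = record
  { adj = λ i j → adj G (f i) (f j)
  ; adj-sym = λ i j → adj-sym G (f i) (f j)
  ; adj-irr = λ i → adj-irr G (f i) }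

Edgeless : ∀ {n} → Graph n → Set
Edgeless G = ∀ u v → ¬ Adj G u v

IsStar : ∀ {n} → Graph n → Set
IsStar {n} G = Σ (Fin n) λ c → ∀ u v → Adj G u v ⇔ ((u ≡ c ⊎ v ≡ c) × u ≢ v)

ExactlyOneEdge : ∀ {n} → Graph n → Set
ExactlyOneEdge {n} G = Σ (Fin n) λ a → Σ (Fin n) λ b →
  Adj G a b × (∀ u v → Adj G u v → (u ≡ a × v ≡ b) ⊎ (u ≡ b × v ≡ a))

-- G is obtained from a star (on the same vertex set) by deleting one edge:
-- there is a centre c and a vertex x ≠ c such that the edges of G are
-- exactly the pairs {c, v} with v ≠ c and v ≠ x.
StarMinusEdge : ∀ {n} → Graph n → Set
StarMinusEdge {n} G = Σ (Fin n) λ c → Σ (Fin n) λ x → x ≢ c ×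
  (∀ u v → Adj G u v ⇔ ((u ≡ c × v ≢ c × v ≢ x) ⊎ (v ≡ c × u ≢ c × u ≢ x)))

-- G is the join of a graph on two vertices {a, b} and an independent set
-- (the remaining vertices): the pair {a,b} is arbitrary, every other pair
-- of distinct vertices is adjacent iff it meets {a, b}.
InAB : ∀ {n} → Fin n → Fin n → Fin n → Set
InAB a b u = u ≡ a ⊎ u ≡ b

JoinTwoIndep : ∀ {n} → Graph n → Set
JoinTwoIndep {n} G = Σ (Fin n) λ a → Σ (Fin n) λ b → a ≢ b ×
  (∀ u v → u ≢ v → ¬ (InAB a b u × InAB a b v) →
     (Adj G u v ⇔ (InAB a b u ⊎ InAB a b v)))

Good : ∀ {h} → Graph h → Set
Good J = ExactlyOneEdge J ⊎ StarMinusEdge J ⊎ JoinTwoIndep J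

-- Ramsey's theorem gives a clique or an independent set of size M = 7k in every graph on
-- 2^(2M) vertices.  A clique of G is independent in the complement and the hypotheses are
-- symmetric under complementation, so it suffices to find J in a graph G that is neither
-- edgeless nor a star and has an independent set I of size 7k.
-- Every outcome is a hub graph: two hubs x, y and k independent leaves, each leaf adjacent to
-- x iff a and to y iff b.  Take an edge yz.  Unless y or z has 3k neighbours in I, the edge yz
-- and k common non-neighbours in I span exactly one edge.  So some x is adjacent to 3k
-- independent vertices X.  If some w ≠ x is not adjacent to x, then k vertices of X are all
-- adjacent to w (a join over {x, w}) or all non-adjacent to w (a star at x minus the edge xw).
-- Otherwise x is adjacent to everything, and since G is not a star there is an edge yz
-- avoiding x; the same split of X along yz gives a join over {x, y} or {x, z}, or one edge.

module Submission where

open import Defs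
open import Level using (Level)
open import Data.Bool using (Bool; true; false; not; T)
open import Data.Bool.Properties using (T-≡; ¬-not; not-¬) renaming (_≟_ to _≟ᵇ_)
open import Data.Empty using (⊥-elim)
open import Data.Fin using (Fin; zero; suc; _≟_)
open import Data.Fin.Properties using (any?)
open import Data.List using (List; []; _∷_; length; filter)
open import Data.List.Properties using (length-tabulate)
open import Data.List.Membership.Propositional using (_∈_)
open import Data.List.Relation.Unary.Any using (here; there)
open import Data.List.Relation.Unary.All as All using (All; []; _∷_)
open import Data.List.Relation.Unary.All.Properties using (all-filter)
open import Data.List.Relation.Unary.AllPairs as AllPairs using (AllPairs; []; _∷_)
open import Data.List.Relation.Unary.Unique.Propositional using (Unique)
open import Data.List.Relation.Unary.Unique.Propositional.Properties using (allFin⁺)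
open import Data.List.Relation.Binary.Sublist.Propositional using (_⊆_; []; _∷_; _∷ʳ_; ⊆-trans)
open import Data.List.Relation.Binary.Sublist.Propositional.Properties
  using (All-resp-⊆; filter-⊆; []⊆-universal)
open import Data.Nat using (ℕ; zero; suc; _+_; _^_; _≤_; s≤s; z≤n; _≤?_)
open import Data.Nat.Properties
  using (≤-trans; ≰⇒>; <⇒≱; +-monoˡ-≤; +-cancelˡ-≤; +-suc; +-identityʳ; m≤n+m; m≤n⇒m≤1+n; m^n>0)
open import Data.Product using (Σ; ∃; ∃₂; _×_; _,_; proj₁; proj₂; map₂)
open import Data.Sum using (_⊎_; inj₁; inj₂)
open import Data.Vec.Functional using () renaming (_∷_ to _◂_)
open import Function using (_∘_; id)
open import Function.Bundles using (_⇔_; mk⇔; Equivalence)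
open import Function.Construct.Composition using (_⇔-∘_)
open import Function.Construct.Symmetry using (⇔-sym)
open import Function.Definitions using (Injective)
open import Relation.Binary.Core using (Rel)
open import Relation.Binary.Definitions using (Symmetric)
open import Relation.Binary.PropositionalEquality
  using (_≡_; _≢_; refl; sym; trans; cong; cong₂; subst; ≢-sym)
open import Relation.Nullary using (¬_; yes; no; contradiction)
open import Relation.Nullary.Decidable using (_×-dec_; ¬?)
open import Relation.Unary using (Pred)

open Equivalence using (to; from)

private
  variable
    a p r : Level
    A : Set a

i+j≤1+m+n⇒i≤m⊎j≤n : ∀ {i j} m n → i + j ≤ suc (m + n) → i ≤ m ⊎ j ≤ n
i+j≤1+m+n⇒i≤m⊎j≤n {i} {j} m n i+j≤ with i ≤? m
... | yes i≤m = inj₁ i≤m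
... | no  i≰m with ≤-trans (+-monoˡ-≤ j (≰⇒> i≰m)) i+j≤
...   | s≤s m+j≤m+n = inj₂ (+-cancelˡ-≤ m j n m+j≤m+n)

2^-halves : ∀ m n → 2 ^ (m + suc n) + 2 ^ (suc m + n) ≡ 2 ^ (suc m + suc n)
2^-halves m n rewrite +-suc m n = cong (2 ^ suc (m + n) +_) (sym (+-identityʳ _))

LargeSublist : ℕ → Pred A p → List A → Set _
LargeSublist m P xs = ∃ λ ys → ys ⊆ xs × m ≤ length ys × All P ys

AllPairs-resp-⊆ : ∀ {R : Rel A r} {xs ys} → xs ⊆ ys → AllPairs R ys → AllPairs R xs
AllPairs-resp-⊆ []          []           = []
AllPairs-resp-⊆ (_ ∷ʳ τ)    (_ ∷ pys)    = AllPairs-resp-⊆ τ pys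
AllPairs-resp-⊆ (refl ∷ τ)  (x∼ys ∷ pys) = All-resp-⊆ τ x∼ys ∷ AllPairs-resp-⊆ τ pys

module _ (f : A → Bool) where

  fibre : Bool → List A → List A
  fibre b = filter (λ x → f x ≟ᵇ b)

  length-fibres : ∀ xs → length (fibre true xs) + length (fibre false xs) ≡ length xs
  length-fibres []       = refl
  length-fibres (x ∷ xs) with f x
  ... | true  = cong suc (length-fibres xs)
  ... | false = trans (+-suc _ _) (cong suc (length-fibres xs))

  pigeonhole : ∀ i j xs → i + j ≤ suc (length xs) →
    LargeSublist i (λ x → f x ≡ true) xs ⊎ LargeSublist j (λ x → f x ≡ false) xs
  pigeonhole i j xs i+j≤
    with i+j≤1+m+n⇒i≤m⊎j≤n _ _ (subst (λ l → i + j ≤ suc l) (sym (length-fibres xs)) i+j≤)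
  ... | inj₁ i≤ = inj₁ (fibre true xs , filter-⊆ _ xs , i≤ , all-filter _ xs)
  ... | inj₂ j≤ = inj₂ (fibre false xs , filter-⊆ _ xs , j≤ , all-filter _ xs)

module _ {R : Rel A r} (R-sym : Symmetric R) where

  pick : ∀ k {xs} → k ≤ length xs → AllPairs R xs →
    Σ (Fin k → A) λ g → (∀ i → g i ∈ xs) × (∀ i j → i ≢ j → R (g i) (g j))
  pick zero    _         _ = (λ ()) , (λ ()) , λ ()
  pick (suc k) {x ∷ xs} (s≤s k≤) (x∼xs ∷ pxs) with pick k k≤ pxs
  ... | g , g∈xs , g-R = x ◂ g , member , related
    where
      member : ∀ i → (x ◂ g) i ∈ x ∷ xs
      member zero    = here refl
      member (suc i) = there (g∈xs i)
      related : ∀ i j → i ≢ j → R ((x ◂ g) i) ((x ◂ g) j)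
      related zero    zero    i≢j = ⊥-elim (i≢j refl)
      related zero    (suc j) _   = All.lookup x∼xs (g∈xs j)
      related (suc i) zero    _   = R-sym (All.lookup x∼xs (g∈xs i))
      related (suc i) (suc j) i≢j = g-R i j (i≢j ∘ cong suc)

◂-injective : ∀ {k} {x : A} {g : Fin k → A} → (∀ i → g i ≢ x) →
  Injective _≡_ _≡_ g → Injective _≡_ _≡_ (x ◂ g)
◂-injective _   _     {zero}  {zero}  _     = refl
◂-injective g≢x _     {zero}  {suc j} x≡gj  = ⊥-elim (g≢x j (sym x≡gj))
◂-injective g≢x _     {suc i} {zero}  gi≡x  = ⊥-elim (g≢x i gi≡x)
◂-injective _   g-inj {suc i} {suc j} gi≡gj = cong suc (g-inj gi≡gj)

_≗ᴬ_ : ∀ {n} → Graph n → Graph n → Set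
G ≗ᴬ H = ∀ u v → adj G u v ≡ adj H u v

Adj-resp : ∀ {n} (G H : Graph n) → G ≗ᴬ H → ∀ u v → Adj G u v ⇔ Adj H u v
Adj-resp _ _ G≗H u v = mk⇔ (subst T (G≗H u v)) (subst T (sym (G≗H u v)))

Good-resp : ∀ {n} (G H : Graph n) → G ≗ᴬ H → Good G → Good H
Good-resp G H G≗H (inj₁ (a , b , ab , only)) =
  inj₁ (a , b , to (Adj-resp G H G≗H a b) ab , λ u v → only u v ∘ from (Adj-resp G H G≗H u v))
Good-resp G H G≗H (inj₂ (inj₁ (c , x , x≢c , edges))) =
  inj₂ (inj₁ (c , x , x≢c , λ u v → edges u v ⇔-∘ ⇔-sym (Adj-resp G H G≗H u v)))
Good-resp G H G≗H (inj₂ (inj₂ (a , b , a≢b , edges))) =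
  inj₂ (inj₂ (a , b , a≢b , λ u v u≢v ¬ab → edges u v u≢v ¬ab ⇔-∘ ⇔-sym (Adj-resp G H G≗H u v)))

Coloured : ∀ {n} → Graph n → Bool → Fin n → Fin n → Set
Coloured G b u v = u ≢ v × adj G u v ≡ b

Homogeneous : ∀ {n} → Graph n → Bool → List (Fin n) → Set
Homogeneous G b = AllPairs (Coloured G b)

Independent : ∀ {n} → Graph n → List (Fin n) → Set
Independent G = Homogeneous G false

module _ {n} (G : Graph n) where

  Coloured-sym : ∀ {b} → Symmetric (Coloured G b)
  Coloured-sym {_} {u} {v} (u≢v , uv) = ≢-sym u≢v , trans (adj-sym G v u) uv

  adjacent⇒≢ : ∀ {u v} → adj G u v ≡ true → u ≢ v
  adjacent⇒≢ {u} u∼u refl = not-¬ u∼u (adj-irr G u)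

  complement-adj : ∀ {u v} → u ≢ v → adj (complement G) u v ≡ not (adj G u v)
  complement-adj {u} {v} u≢v with u ≟ v
  ... | yes u≡v = ⊥-elim (u≢v u≡v)
  ... | no  _   = refl

  clique⇒co-independent : ∀ {C} → Homogeneous G true C → Independent (complement G) C
  clique⇒co-independent = AllPairs.map λ (u≢v , uv) → u≢v , trans (complement-adj u≢v) (cong not uv)

  induced-complement : ∀ {h} {f : Fin h → Fin n} → Injective _≡_ _≡_ f →
    induced (complement G) f ≗ᴬ complement (induced G f)
  induced-complement {f = f} f-inj i j with i ≟ j
  ... | yes refl = adj-irr (complement G) (f i)
  ... | no  i≢j  = complement-adj (i≢j ∘ f-inj)

  cone : ∀ {b v C T L} → C ⊆ T → T ⊆ L → All (v ≢_) L → All (λ s → adj G v s ≡ b) T →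
    All (Coloured G b v) C
  cone C⊆T T⊆L v∉L v∼T = All-resp-⊆ C⊆T (All.zip (All-resp-⊆ T⊆L v∉L , v∼T))

  ramsey : ∀ a c {L} → Unique L → 2 ^ (a + c) ≤ length L →
      (∃ λ C → C ⊆ L × a ≤ length C × Homogeneous G true C)
    ⊎ (∃ λ C → C ⊆ L × c ≤ length C × Homogeneous G false C)
  ramsey zero    c       _ _ = inj₁ ([] , []⊆-universal _ , z≤n , [])
  ramsey (suc a) zero    _ _ = inj₂ ([] , []⊆-universal _ , z≤n , [])
  ramsey (suc a) (suc c) {[]} _ bound = contradiction bound (<⇒≱ (m^n>0 2 (suc a + suc c)))
  ramsey (suc a) (suc c) {v ∷ L} (v∉L ∷ unique) bound
    with pigeonhole (adj G v) (2 ^ (a + suc c)) (2 ^ (suc a + c)) L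
           (subst (_≤ suc (length L)) (sym (2^-halves a c)) bound)
  ... | inj₁ (T , T⊆L , big , v∼T) with ramsey a (suc c) (AllPairs-resp-⊆ T⊆L unique) big
  ...   | inj₁ (C , C⊆T , a≤ , hom) =
          inj₁ (v ∷ C , refl ∷ ⊆-trans C⊆T T⊆L , s≤s a≤ , cone C⊆T T⊆L v∉L v∼T ∷ hom)
  ...   | inj₂ (C , C⊆T , c≤ , hom) = inj₂ (C , v ∷ʳ ⊆-trans C⊆T T⊆L , c≤ , hom)
  ramsey (suc a) (suc c) {v ∷ L} (v∉L ∷ unique) bound
    | inj₂ (F , F⊆L , big , v≁F) with ramsey (suc a) c (AllPairs-resp-⊆ F⊆L unique) big
  ...   | inj₁ (C , C⊆F , a≤ , hom) = inj₁ (C , v ∷ʳ ⊆-trans C⊆F F⊆L , a≤ , hom)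
  ...   | inj₂ (C , C⊆F , c≤ , hom) =
          inj₂ (v ∷ C , refl ∷ ⊆-trans C⊆F F⊆L , s≤s c≤ , cone C⊆F F⊆L v∉L v≁F ∷ hom)

module _ (e a b : Bool) {k : ℕ} where

  hubGraph-adj : Fin (2 + k) → Fin (2 + k) → Bool
  hubGraph-adj zero          zero          = false
  hubGraph-adj zero          (suc zero)    = e
  hubGraph-adj zero          (suc (suc _)) = a
  hubGraph-adj (suc zero)    zero          = e
  hubGraph-adj (suc zero)    (suc zero)    = false
  hubGraph-adj (suc zero)    (suc (suc _)) = b
  hubGraph-adj (suc (suc _)) zero          = a
  hubGraph-adj (suc (suc _)) (suc zero)    = b
  hubGraph-adj (suc (suc _)) (suc (suc _)) = false

  hubGraph-sym : ∀ u v → hubGraph-adj u v ≡ hubGraph-adj v u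
  hubGraph-sym zero          zero          = refl
  hubGraph-sym zero          (suc zero)    = refl
  hubGraph-sym zero          (suc (suc _)) = refl
  hubGraph-sym (suc zero)    zero          = refl
  hubGraph-sym (suc zero)    (suc zero)    = refl
  hubGraph-sym (suc zero)    (suc (suc _)) = refl
  hubGraph-sym (suc (suc _)) zero          = refl
  hubGraph-sym (suc (suc _)) (suc zero)    = refl
  hubGraph-sym (suc (suc _)) (suc (suc _)) = refl

  hubGraph-irr : ∀ u → hubGraph-adj u u ≡ false
  hubGraph-irr zero          = refl
  hubGraph-irr (suc zero)    = refl
  hubGraph-irr (suc (suc _)) = refl

hubGraph : Bool → Bool → Bool → ∀ k → Graph (2 + k)
hubGraph e a b k = record
  { adj = hubGraph-adj e a b ; adj-sym = hubGraph-sym e a b ; adj-irr = hubGraph-irr e a b }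

hubGraph-one-edge : ∀ k → Good (hubGraph true false false k)
hubGraph-one-edge k = inj₁ (zero , suc zero , _ , only)
  where
    only : ∀ u v → Adj (hubGraph true false false k) u v →
      (u ≡ zero × v ≡ suc zero) ⊎ (u ≡ suc zero × v ≡ zero)
    only zero       (suc zero) _ = inj₁ (refl , refl)
    only (suc zero) zero       _ = inj₂ (refl , refl)
    only zero          zero          ()
    only zero          (suc (suc _)) ()
    only (suc zero)    (suc zero)    ()
    only (suc zero)    (suc (suc _)) ()
    only (suc (suc _)) zero          ()
    only (suc (suc _)) (suc zero)    ()
    only (suc (suc _)) (suc (suc _)) ()

hubGraph-join : ∀ e k → Good (hubGraph e true true k)
hubGraph-join e k = inj₂ (inj₂ (zero , suc zero , (λ ()) , edges))
  where
    hubs = InAB {2 + k} zero (suc zero)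
    edges : ∀ u v → u ≢ v → ¬ (hubs u × hubs v) →
      Adj (hubGraph e true true k) u v ⇔ (hubs u ⊎ hubs v)
    edges zero          zero          u≢v _ = ⊥-elim (u≢v refl)
    edges (suc zero)    (suc zero)    u≢v _ = ⊥-elim (u≢v refl)
    edges zero          (suc zero)    _ ¬hubs = ⊥-elim (¬hubs (inj₁ refl , inj₂ refl))
    edges (suc zero)    zero          _ ¬hubs = ⊥-elim (¬hubs (inj₂ refl , inj₁ refl))
    edges zero          (suc (suc _)) _ _ = mk⇔ (λ _ → inj₁ (inj₁ refl)) _
    edges (suc zero)    (suc (suc _)) _ _ = mk⇔ (λ _ → inj₁ (inj₂ refl)) _
    edges (suc (suc _)) zero          _ _ = mk⇔ (λ _ → inj₂ (inj₁ refl)) _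
    edges (suc (suc _)) (suc zero)    _ _ = mk⇔ (λ _ → inj₂ (inj₂ refl)) _
    edges (suc (suc _)) (suc (suc _)) _ _ =
      mk⇔ (λ ()) λ { (inj₁ (inj₁ ())) ; (inj₁ (inj₂ ())) ; (inj₂ (inj₁ ())) ; (inj₂ (inj₂ ())) }

hubGraph-star-minus-edge : ∀ k → Good (hubGraph false true false k)
hubGraph-star-minus-edge k = inj₂ (inj₁ (zero , suc zero , (λ ()) , edges))
  where
    edges : ∀ u v → Adj (hubGraph false true false k) u v ⇔
      ((u ≡ zero × v ≢ zero × v ≢ suc zero) ⊎ (v ≡ zero × u ≢ zero × u ≢ suc zero))
    edges zero          (suc (suc _)) = mk⇔ (λ _ → inj₁ (refl , (λ ()) , (λ ()))) _
    edges (suc (suc _)) zero          = mk⇔ (λ _ → inj₂ (refl , (λ ()) , (λ ()))) _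
    edges zero          zero          =
      mk⇔ (λ ()) λ { (inj₁ (_ , v≢0 , _)) → v≢0 refl ; (inj₂ (_ , u≢0 , _)) → u≢0 refl }
    edges zero          (suc zero)    =
      mk⇔ (λ ()) λ { (inj₁ (_ , _ , v≢1)) → v≢1 refl ; (inj₂ (() , _)) }
    edges (suc zero)    zero          =
      mk⇔ (λ ()) λ { (inj₁ (() , _)) ; (inj₂ (_ , _ , u≢1)) → u≢1 refl }
    edges (suc zero)    (suc zero)    = mk⇔ (λ ()) λ { (inj₁ (() , _)) ; (inj₂ (() , _)) }
    edges (suc zero)    (suc (suc _)) = mk⇔ (λ ()) λ { (inj₁ (() , _)) ; (inj₂ (() , _)) }
    edges (suc (suc _)) (suc zero)    = mk⇔ (λ ()) λ { (inj₁ (() , _)) ; (inj₂ (() , _)) }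
    edges (suc (suc _)) (suc (suc _)) = mk⇔ (λ ()) λ { (inj₁ (() , _)) ; (inj₂ (() , _)) }

module _ {n} (G : Graph n) where

  GoodInduced : ℕ → Set
  GoodInduced h = Σ (Fin h → Fin n) λ f → Injective _≡_ _≡_ f × Good (induced G f)

  record HubConfig (e a b : Bool) (k : ℕ) : Set where
    constructor hubConfig
    field
      {x y}            : Fin n
      {pool}           : List (Fin n)
      x≢y              : x ≢ y
      x∼y              : adj G x y ≡ e
      pool-independent : Independent G pool
      x∼pool           : All (λ s → adj G x s ≡ a) pool
      leaves           : LargeSublist k (λ s → adj G y s ≡ b) pool

  x-profile : ∀ {e a b x y s} → adj G x y ≡ e → adj G x s ≡ a → adj G y s ≡ b →
    s ≡ x → (a , b) ≡ (false , e)
  x-profile {y = y} x∼y x∼s y∼s refl =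
    cong₂ _,_ (trans (sym x∼s) (adj-irr G _)) (trans (sym y∼s) (trans (adj-sym G y _) x∼y))

  y-profile : ∀ {e a b x y s} → adj G x y ≡ e → adj G x s ≡ a → adj G y s ≡ b →
    s ≡ y → (a , b) ≡ (e , false)
  y-profile x∼y x∼s y∼s refl = cong₂ _,_ (trans (sym x∼s) x∼y) (trans (sym y∼s) (adj-irr G _))

  induced-hubs : ∀ {e a b k x y} {g : Fin k → Fin n} → adj G x y ≡ e →
    (∀ i → adj G x (g i) ≡ a) → (∀ i → adj G y (g i) ≡ b) →
    (∀ i j → i ≢ j → Coloured G false (g i) (g j)) →
    induced G (x ◂ y ◂ g) ≗ᴬ hubGraph e a b k
  induced-hubs {e} {a} {b} {k} {x} {y} {g} x∼y x∼g y∼g g-independent = adjacency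
    where
      adjacency : induced G (x ◂ y ◂ g) ≗ᴬ hubGraph e a b k
      adjacency zero          zero          = adj-irr G x
      adjacency zero          (suc zero)    = x∼y
      adjacency zero          (suc (suc j)) = x∼g j
      adjacency (suc zero)    zero          = trans (adj-sym G y x) x∼y
      adjacency (suc zero)    (suc zero)    = adj-irr G y
      adjacency (suc zero)    (suc (suc j)) = y∼g j
      adjacency (suc (suc i)) zero          = trans (adj-sym G (g i) x) (x∼g i)
      adjacency (suc (suc i)) (suc zero)    = trans (adj-sym G (g i) y) (y∼g i)
      adjacency (suc (suc i)) (suc (suc j)) with i ≟ j
      ... | yes refl = adj-irr G (g i)
      ... | no  i≢j  = proj₂ (g-independent i j i≢j)

  -- The side conditions keep the leaves apart from the hubs.
  realise : ∀ {e a b k} → Good (hubGraph e a b k) →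
    (a , b) ≢ (false , e) → (a , b) ≢ (e , false) → HubConfig e a b k → GoodInduced (2 + k)
  realise {e} {a} {b} {k} good leaf≢x leaf≢y
          (hubConfig {x} {y} x≢y x∼y pool-independent x∼pool (S , S⊆pool , k≤∣S∣ , y∼S))
    with pick (Coloured-sym G) k k≤∣S∣ (AllPairs-resp-⊆ S⊆pool pool-independent)
  ... | g , g∈S , g-independent = x ◂ y ◂ g , injective ,
        Good-resp (hubGraph e a b k) (induced G (x ◂ y ◂ g))
          (λ u v → sym (induced-hubs x∼y x∼g y∼g g-independent u v)) good
    where
      x∼g : ∀ i → adj G x (g i) ≡ a
      x∼g i = All.lookup (All-resp-⊆ S⊆pool x∼pool) (g∈S i)
      y∼g : ∀ i → adj G y (g i) ≡ b
      y∼g i = All.lookup y∼S (g∈S i)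

      g-injective : Injective _≡_ _≡_ g
      g-injective {i} {j} gi≡gj with i ≟ j
      ... | yes i≡j = i≡j
      ... | no  i≢j = ⊥-elim (proj₁ (g-independent i j i≢j) gi≡gj)

      injective : Injective _≡_ _≡_ (x ◂ y ◂ g)
      injective = ◂-injective
        (λ { zero → ≢-sym x≢y ; (suc i) → leaf≢x ∘ x-profile x∼y (x∼g i) (y∼g i) })
        (◂-injective (λ i → leaf≢y ∘ y-profile x∼y (x∼g i) (y∼g i)) g-injective)

  one-edge : ∀ {k} → HubConfig true false false k → GoodInduced (2 + k)
  one-edge = realise (hubGraph-one-edge _) (λ ()) (λ ())

  join : ∀ {e k} → HubConfig e true true k → GoodInduced (2 + k)
  join = realise (hubGraph-join _ _) (λ ()) (λ ())

  star-minus-edge : ∀ {k} → HubConfig false true false k → GoodInduced (2 + k)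
  star-minus-edge = realise (hubGraph-star-minus-edge _) (λ ()) (λ ())

  find-edge : ¬ Edgeless G → ∃₂ λ u v → adj G u v ≡ true
  find-edge ¬edgeless with any? (λ u → any? (λ v → adj G u v ≟ᵇ true))
  ... | yes (u , v , u∼v) = u , v , u∼v
  ... | no  ¬edge = ⊥-elim (¬edgeless λ u v u∼v → ¬edge (u , v , to T-≡ u∼v))

  non-neighbour-or-universal : ∀ x →
    (∃ λ w → w ≢ x × adj G x w ≡ false) ⊎ (∀ w → w ≢ x → adj G x w ≡ true)
  non-neighbour-or-universal x with any? (λ w → ¬? (w ≟ x) ×-dec adj G x w ≟ᵇ false)
  ... | yes found = inj₁ found
  ... | no  none  = inj₂ λ w w≢x → ¬-not λ x≁w → none (w , w≢x , x≁w)

  universal⇒star : ∀ {c} → (∀ w → w ≢ c → adj G c w ≡ true) →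
    (∀ u v → u ≢ c → v ≢ c → adj G u v ≢ true) → IsStar G
  universal⇒star {c} c∼all no-edge = c , λ u v → mk⇔ (edge⇒star u v) (star⇒edge u v)
    where
      edge⇒star : ∀ u v → Adj G u v → (u ≡ c ⊎ v ≡ c) × u ≢ v
      edge⇒star u v uv with u ≟ c | v ≟ c
      ... | yes u≡c | _       = inj₁ u≡c , adjacent⇒≢ G (to T-≡ uv)
      ... | no  _   | yes v≡c = inj₂ v≡c , adjacent⇒≢ G (to T-≡ uv)
      ... | no  u≢c | no  v≢c = ⊥-elim (no-edge u v u≢c v≢c (to T-≡ uv))
      star⇒edge : ∀ u v → (u ≡ c ⊎ v ≡ c) × u ≢ v → Adj G u v
      star⇒edge u v (inj₁ refl , u≢v) = from T-≡ (c∼all v (≢-sym u≢v))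
      star⇒edge u v (inj₂ refl , u≢v) = from T-≡ (trans (adj-sym G u c) (c∼all u u≢v))

  ¬star⇒edge-avoiding : ∀ {c} → ¬ IsStar G → (∀ w → w ≢ c → adj G c w ≡ true) →
    ∃₂ λ u v → u ≢ c × v ≢ c × adj G u v ≡ true
  ¬star⇒edge-avoiding {c} ¬star c∼all
    with any? (λ u → any? (λ v → ¬? (u ≟ c) ×-dec ¬? (v ≟ c) ×-dec adj G u v ≟ᵇ true))
  ... | yes edge = edge
  ... | no  none =
        ⊥-elim (¬star (universal⇒star c∼all λ u v u≢c v≢c u∼v → none (u , v , u≢c , v≢c , u∼v)))

  edge-split : ∀ {i j k y z I} → adj G y z ≡ true → Independent G I →
    i + (j + k) ≤ length I →
      LargeSublist i (λ s → adj G y s ≡ true) I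
    ⊎ LargeSublist j (λ s → adj G z s ≡ true) I
    ⊎ GoodInduced (2 + k)
  edge-split {i} {j} {k} {y} {z} {I} y∼z independent bound
    with pigeonhole (adj G y) i (j + k) I (m≤n⇒m≤1+n bound)
  ... | inj₁ y∼many = inj₁ y∼many
  ... | inj₂ (F , F⊆I , j+k≤ , y≁F) with pigeonhole (adj G z) j k F (m≤n⇒m≤1+n j+k≤)
  ...   | inj₁ (S , S⊆F , j≤ , z∼S) = inj₂ (inj₁ (S , ⊆-trans S⊆F F⊆I , j≤ , z∼S))
  ...   | inj₂ leaves = inj₂ (inj₂ (one-edge
          (hubConfig (adjacent⇒≢ G y∼z) y∼z (AllPairs-resp-⊆ F⊆I independent) y≁F leaves)))

  hub⇒good : ∀ {k x X} → ¬ IsStar G → Independent G X → All (λ s → adj G x s ≡ true) X →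
    k + (k + k) ≤ length X → GoodInduced (2 + k)
  hub⇒good {k} {x} {X} ¬star independent x∼X bound with non-neighbour-or-universal x
  ... | inj₁ (w , w≢x , x≁w)
      with pigeonhole (adj G w) k k X (m≤n⇒m≤1+n (≤-trans (m≤n+m (k + k) k) bound))
  ...   | inj₁ leaves = join (hubConfig (≢-sym w≢x) x≁w independent x∼X leaves)
  ...   | inj₂ leaves = star-minus-edge (hubConfig (≢-sym w≢x) x≁w independent x∼X leaves)
  hub⇒good ¬star independent x∼X bound | inj₂ x∼all
      with ¬star⇒edge-avoiding ¬star x∼all
  ... | y , z , y≢x , z≢x , y∼z with edge-split y∼z independent bound
  ...   | inj₁ leaves = join (hubConfig (≢-sym y≢x) (x∼all y y≢x) independent x∼X leaves)
  ...   | inj₂ (inj₁ leaves) =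
          join (hubConfig (≢-sym z≢x) (x∼all z z≢x) independent x∼X leaves)
  ...   | inj₂ (inj₂ good) = good

  independent⇒good : ∀ {k I} → ¬ Edgeless G → ¬ IsStar G → Independent G I →
    (k + (k + k)) + ((k + (k + k)) + k) ≤ length I → GoodInduced (2 + k)
  independent⇒good ¬edgeless ¬star independent bound with find-edge ¬edgeless
  ... | y , z , y∼z with edge-split y∼z independent bound
  ...   | inj₁ (X , X⊆I , big , y∼X) =
          hub⇒good ¬star (AllPairs-resp-⊆ X⊆I independent) y∼X big
  ...   | inj₂ (inj₁ (X , X⊆I , big , z∼X)) =
          hub⇒good ¬star (AllPairs-resp-⊆ X⊆I independent) z∼X big
  ...   | inj₂ (inj₂ good) = good

lemma3p9 : (h : ℕ) → 2 ≤ h → Σ ℕ λ N →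
    ∀ {n} (G : Graph n) → N ≤ n →
      ¬ Edgeless G → ¬ IsStar G →
      ¬ Edgeless (complement G) → ¬ IsStar (complement G) →
      Σ (Fin h → Fin n) λ f → Injective _≡_ _≡_ f ×
        (Good (induced G f) ⊎ Good (complement (induced G f)))
lemma3p9 zero          ()
lemma3p9 (suc zero)    (s≤s ())
lemma3p9 (suc (suc k)) _ = 2 ^ (M + M) , find
  where
    M : ℕ
    M = (k + (k + k)) + ((k + (k + k)) + k)

    find : ∀ {n} (G : Graph n) → 2 ^ (M + M) ≤ n →
      ¬ Edgeless G → ¬ IsStar G → ¬ Edgeless (complement G) → ¬ IsStar (complement G) →
      Σ (Fin (2 + k) → Fin n) λ f → Injective _≡_ _≡_ f ×
        (Good (induced G f) ⊎ Good (complement (induced G f)))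
    find {n} G N≤n ¬edgeless ¬star ¬co-edgeless ¬co-star
      with ramsey G M M (allFin⁺ n) (subst (2 ^ (M + M) ≤_) (sym (length-tabulate id)) N≤n)
    ... | inj₂ (_ , _ , M≤ , independent) =
          map₂ (map₂ inj₁) (independent⇒good G ¬edgeless ¬star independent M≤)
    ... | inj₁ (_ , _ , M≤ , clique)
        with independent⇒good (complement G) ¬co-edgeless ¬co-star
               (clique⇒co-independent G clique) M≤
    ...   | f , f-injective , good =
            f , f-injective , inj₂ (Good-resp (induced (complement G) f) (complement (induced G f))
              (induced-complement G f-injective) good)
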